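{- For each $k\in\mathbb N$, $\mathcal{IS}_{br}/O(n^k)\subsetneq\mathcal{IS}_{br}/O(n^{k+1})$.
   Context: Let $\mathbb B=\{\mathsf T,\mathsf F\}$. There are Boolean registers named $\mathtt{in}{:}i$ ($i\ge1$), $\mathtt{aux}{:}i$ ($i\ge1$) and $\mathtt{out}$, processing methods $\mathtt{set{:}T}$ (content becomes $\mathsf T$, reply $\mathsf T$), $\mathtt{set{:}F}$ (content becomes $\mathsf F$, reply $\mathsf F$), $\mathtt{get}$ (no change, reply is the content). Basic instructions are $f.m$ ($f$ register name, $m$ method). Primitive instructions: for each basic instruction $a$, the plain instruction $a$, positive test $+a$, negative test $-a$; forward jumps $\#l$ ($l\in\mathbb N$); termination $!$. An instruction sequence is a finite non-empty sequence $X=u_1;\dots;u_k$ of primitive instructions, $|X|=k$. Execution starts at $u_1$: $a$ executes $a$ and proceeds with the next instruction; $+a$ executes $a$ and proceeds with the next instruction if the reply is $\mathsf T$, otherwise skips the next instruction and proceeds with the one after; $-a$ likewise with reply roles reversed; $\#l$ proceeds with the $l$-th next instruction ($\#0$ causes inaction); $!$ terminates; if there is no instruction to proceed with, inaction occurs. $\mathcal{IS}_{br}$ is the set of instruction sequences whose basic instructions are all of the forms $\mathtt{in}{:}i.\mathtt{get}$, $\mathtt{aux}{:}i.\mathtt{get}$, $\mathtt{aux}{:}i.\mathtt{set{:}}b$, $\mathtt{out}.\mathtt{set{:}}b$ ($b\in\mathbb B$). $X$ computes $f:\mathbb B^n\to\mathbb B$ if for all $b_1,\dots,b_n$, executing $X$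 with $\mathtt{in}{:}i$ initially $b_i$ ($i\le n$) and all auxiliary registers and $\mathtt{out}$ initially $\mathsf F$, execution never executes an instruction on $\mathtt{in}{:}i$ with $i>n$, ends by executing $!$, and leaves $f(b_1,\dots,b_n)$ in $\mathtt{out}$. A Boolean function family is a sequence $(f_n)_{n\in\mathbb N}$ with $f_n:\mathbb B^n\to\mathbb B$. For $\mathcal{IS}\subseteq\mathcal{IS}_{br}$ and a set $\mathcal F$ of functions $\mathbb N\to\mathbb N$, $\mathcal{IS}/\mathcal F$ is the class of Boolean function families $(f_n)$ for which there is $h\in\mathcal F$ such that for every $n$ some $X\in\mathcal{IS}$ computes $f_n$ with $|X|\le h(n)$. $\mathcal{IS}/O(g(n))$ denotes $\mathcal{IS}/\{h:\mathbb N\to\mathbb N\mid h(n)=O(g(n))\}$. -}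

module Defs where

open import Data.Bool using (Bool; true; false)
open import Data.Nat using (ℕ; zero; suc; _*_; _^_; _≤_)
open import Data.List using (List; []; _∷_)
open import Data.List.NonEmpty using (List⁺; toList) renaming (length to length⁺)
open import Data.Vec using (Vec; []; _∷_)
open import Data.Maybe using (Maybe; just; nothing)
open import Data.Product using (Σ; _×_; ∃)
open import Relation.Binary.PropositionalEquality using (_≡_)

-- Basic instructions allowed in IS_br.
-- Register indices are shifted: index i : ℕ denotes register in:(i+1) / aux:(i+1).
data BasicInstr : Set where
  inGet   : ℕ → BasicInstr
  auxGet  : ℕ → BasicInstr
  auxSet  : ℕ → Bool → BasicInstr
  outSet  : Bool → BasicInstr

data PrimInstr : Set where
  plain : BasicInstr → PrimInstr
  ptest : BasicInstr → PrimInstr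
  ntest : BasicInstr → PrimInstr
  jump  : ℕ → PrimInstr
  halt  : PrimInstr

ISbr : Set
ISbr = List⁺ PrimInstr

record State : Set where
  constructor st
  field
    aux : ℕ → Bool
    out : Bool
open State

initState : State
initState = st (λ _ → false) false

data Outcome : Set where
  terminated : Bool → Outcome
  inaction   : Outcome
  badInput   : Outcome

readIn : ∀ {n} → Vec Bool n → ℕ → Maybe Bool
readIn []      _       = nothing
readIn (b ∷ v) zero    = just b
readIn (b ∷ v) (suc i) = readIn v i

updAux : (ℕ → Bool) → ℕ → Bool → ℕ → Bool
updAux f zero    b zero    = b
updAux f zero    b (suc j) = f (suc j)
updAux f (suc i) b zero    = f zero
updAux f (suc i) b (suc j) = updAux (λ x → f (suc x)) i b j

doBasic : ∀ {n} → Vec Bool n → BasicInstr → State → Maybe (Bool × State)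
doBasic v (inGet i) s with readIn v i
... | nothing = nothing
... | just b  = just (b Data.Product., s)
doBasic v (auxGet i) s   = just (aux s i Data.Product., s)
doBasic v (auxSet i b) s = just (b Data.Product., st (updAux (aux s) i b) (out s))
doBasic v (outSet b) s   = just (b Data.Product., st (aux s) b)

-- exec k rest s : proceed with the k-th instruction (0-based) of the remaining list `rest`.
exec : ∀ {n} → Vec Bool n → ℕ → List PrimInstr → State → Outcome
exec v k       []       s = inaction
exec v (suc k) (_ ∷ xs) s = exec v k xs s
exec v zero    (u ∷ xs) s = step u
  where
  step : PrimInstr → Outcome
  step halt             = terminated (out s)
  step (jump zero)      = inaction
  step (jump (suc l))   = exec v l xs s
  step (plain a) with doBasic v a s
  ... | nothing = badInput
  ... | just (_ Data.Product., s') = exec v zero xs s'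
  step (ptest a) with doBasic v a s
  ... | nothing = badInput
  ... | just (true  Data.Product., s') = exec v zero xs s'
  ... | just (false Data.Product., s') = exec v 1 xs s'
  step (ntest a) with doBasic v a s
  ... | nothing = badInput
  ... | just (false Data.Product., s') = exec v zero xs s'
  ... | just (true  Data.Product., s') = exec v 1 xs s'

run : ∀ {n} → ISbr → Vec Bool n → Outcome
run X v = exec v zero (toList X) initState

Computes : ∀ {n} → ISbr → (Vec Bool n → Bool) → Set
Computes X f = ∀ v → run X v ≡ terminated (f v)

BFFamily : Set
BFFamily = (n : ℕ) → Vec Bool n → Bool

BigO : (ℕ → ℕ) → (ℕ → ℕ) → Set
BigO h g = Σ ℕ λ c → Σ ℕ λ N → ∀ n → N ≤ n → h n ≤ c * g n

InISbrO : (ℕ → ℕ) → BFFamily → Set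
InISbrO g F = Σ (ℕ → ℕ) λ h → BigO h g ×
  (∀ n → Σ ISbr λ X → Computes X (F n) × length⁺ X ≤ h n)

-- At input size n the family below depends only on its first m = (k+1)⌊log₂ n⌋ inputs,
-- so a decision tree with 4·2^m = O(n^(k+1)) instructions computes it. Conversely, renaming
-- auxiliary registers after their first use and capping input indices and jump lengths maps
-- every program of length ≤ L to one of at most (13(n+L+2)+8)^L normal forms with the same
-- behaviour. For n = 2^j and L = j·n^k these are fewer than 2^(2^m) = 2^(n^(k+1)), the number of
-- Boolean functions of m inputs, so pigeonhole yields a function of the first m inputs that no
-- program of length ≤ L computes; as c·n^k ≤ j·n^k for large j, the family is not in O(n^k).
module Submission where

open import Defs
open import Data.Bool using (Bool; true; false)
open import Data.Empty using (⊥; ⊥-elim)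
open import Data.List using (List; []; _∷_; _++_; map; length; upTo; take; drop; cartesianProductWith)
open import Data.List.Properties
  using ( length-map; length-++; length-upTo; length-take; length-drop; ++-assoc; ++-identityʳ
        ; map-++; map-∘; map-cong; take++drop≡id)
open import Data.List.Membership.Propositional using (_∈_; _∉_)
open import Data.List.Membership.Propositional.Properties
  using (∈-map⁺; ∈-++⁺ˡ; ∈-++⁺ʳ; ∈-upTo⁺; ∈-cartesianProductWith⁺)
open import Data.List.NonEmpty using (List⁺; _∷_; toList) renaming (length to length⁺)
open import Data.List.Relation.Unary.All as All using (All; []; _∷_)
import Data.List.Relation.Unary.All.Properties as All
open import Data.List.Relation.Unary.Any using (here; there)
open import Data.Maybe using (Maybe; just; nothing)
open import Data.Maybe.Properties using (just-injective) renaming (≡-dec to ≡-decMaybe)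
open import Data.Nat
  using ( ℕ; zero; suc; _+_; _*_; _^_; _∸_; _≤_; _<_; _⊓_; _≟_; _<?_; z≤n; s≤s; z<s
        ; ⌊_/2⌋; ⌈_/2⌉; NonZero; >-nonZero)
open import Data.Nat.Induction using (<-wellFounded)
open import Data.Nat.Logarithm using (⌊log₂_⌋; ⌊log₂[2^n]⌋≡n)
open import Data.Nat.Logarithm.Core using (⌊log2⌋)
open import Data.Nat.Properties
open import Data.Nat.Tactic.RingSolver using (solve-∀)
open import Data.Product using (Σ; _×_; _,_; proj₁; proj₂; ∃-syntax)
open import Data.Vec using (Vec; []; _∷_)
open import Function using (_∘_; _$_; flip)
open import Induction.WellFounded using (Acc; acc)
open import Relation.Binary.PropositionalEquality
open import Relation.Nullary using (¬_; Dec; yes; no)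

readIn-⊓ : ∀ {n} (v : Vec Bool n) i → readIn v (i ⊓ n) ≡ readIn v i
readIn-⊓ []      i       = refl
readIn-⊓ (b ∷ v) zero    = refl
readIn-⊓ (b ∷ v) (suc i) = readIn-⊓ v i

updAux-same : ∀ f i b → updAux f i b i ≡ b
updAux-same f zero    b = refl
updAux-same f (suc i) b = updAux-same (f ∘ suc) i b

updAux-other : ∀ f {i j} b → i ≢ j → updAux f i b j ≡ f j
updAux-other f {zero}  {zero}  b i≢j = ⊥-elim (i≢j refl)
updAux-other f {zero}  {suc j} b i≢j = refl
updAux-other f {suc i} {zero}  b i≢j = refl
updAux-other f {suc i} {suc j} b i≢j = updAux-other (f ∘ suc) b (i≢j ∘ cong suc)

exec-⊓ : ∀ {n} (v : Vec Bool n) k {L} xs s → length xs ≤ L → exec v (k ⊓ L) xs s ≡ exec v k xs s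
exec-⊓ v k       []       s _         = refl
exec-⊓ v zero    (u ∷ xs) s _         = refl
exec-⊓ v (suc k) (u ∷ xs) s (s≤s xs≤L) = exec-⊓ v k xs s xs≤L

exec-++ : ∀ {n} (v : Vec Bool n) xs {ys} k s → exec v (length xs + k) (xs ++ ys) s ≡ exec v k ys s
exec-++ v []       k s = refl
exec-++ v (x ∷ xs) k s = exec-++ v xs k s

auxRegister : BasicInstr → Maybe ℕ
auxRegister (inGet i)    = nothing
auxRegister (auxGet i)   = just i
auxRegister (auxSet i b) = just i
auxRegister (outSet b)   = nothing

auxRegisterOf : PrimInstr → Maybe ℕ
auxRegisterOf (plain a) = auxRegister a
auxRegisterOf (ptest a) = auxRegister a
auxRegisterOf (ntest a) = auxRegister a
auxRegisterOf (jump l)  = nothing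
auxRegisterOf halt      = nothing

uses? : ∀ u i → Dec (auxRegisterOf u ≡ just i)
uses? u i = ≡-decMaybe _≟_ (auxRegisterOf u) (just i)

-- Equals length P when aux:i does not occur in P.
firstUse : List PrimInstr → ℕ → ℕ
firstUse []       i = 0
firstUse (u ∷ us) i with uses? u i
... | yes _ = 0
... | no  _ = suc (firstUse us i)

InUse : List PrimInstr → ℕ → Set
InUse P i = firstUse P i < length P

firstUse-injective : ∀ P {i j} → InUse P i → firstUse P i ≡ firstUse P j → i ≡ j
firstUse-injective (u ∷ us) {i} {j} used eq
  with uses? u i | uses? u j
... | yes ui | yes uj = just-injective (trans (sym ui) uj)
... | no  _  | no  _  = firstUse-injective us (≤-pred used) (suc-injective eq)

firstUse-∷ : ∀ u us i → firstUse (u ∷ us) i ≤ suc (firstUse us i)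
firstUse-∷ u us i with uses? u i
... | yes _ = z≤n
... | no  _ = ≤-refl

RegistersInUse : List PrimInstr → PrimInstr → Set
RegistersInUse P u = ∀ {i} → auxRegisterOf u ≡ just i → InUse P i

registersInUse : ∀ P → All (RegistersInUse P) P
registersInUse []       = []
registersInUse (u ∷ us) = head-in-use ∷ All.map (λ {w} → in-use-later {w}) (registersInUse us)
  where
  head-in-use : RegistersInUse (u ∷ us) u
  head-in-use {i} uses-i with uses? u i
  ... | yes _   = s≤s z≤n
  ... | no  ¬ui = ⊥-elim (¬ui uses-i)
  in-use-later : ∀ {w} → RegistersInUse us w → RegistersInUse (u ∷ us) w
  in-use-later in-use {i} uses-i = ≤-<-trans (firstUse-∷ u us i) (s≤s (in-use uses-i))

length-cartesianProductWith : ∀ {A B C : Set} (f : A → B → C) xs ys →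
                              length (cartesianProductWith f xs ys) ≡ length xs * length ys
length-cartesianProductWith f []       ys = refl
length-cartesianProductWith f (x ∷ xs) ys = begin
  length (map (f x) ys ++ cartesianProductWith f xs ys) ≡⟨ length-++ (map (f x) ys) ⟩
  length (map (f x) ys) + length (cartesianProductWith f xs ys)
    ≡⟨ cong₂ _+_ (length-map (f x) ys) (length-cartesianProductWith f xs ys) ⟩
  length ys + length xs * length ys ∎
  where open ≡-Reasoning

listsOfLength≤ : ∀ {A : Set} → List A → ℕ → List (List A)
listsOfLength≤ xs zero    = [] ∷ []
listsOfLength≤ xs (suc L) = [] ∷ cartesianProductWith _∷_ xs (listsOfLength≤ xs L)

∈-listsOfLength≤ : ∀ {A : Set} {xs : List A} {L} ys → All (_∈ xs) ys → length ys ≤ L →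
                   ys ∈ listsOfLength≤ xs L
∈-listsOfLength≤ {L = zero}  []       _          _           = here refl
∈-listsOfLength≤ {L = suc L} []       _          _           = here refl
∈-listsOfLength≤ {L = suc L} (y ∷ ys) (y∈ ∷ ys∈) (s≤s ys≤L) =
  there (∈-cartesianProductWith⁺ _∷_ y∈ (∈-listsOfLength≤ ys ys∈ ys≤L))

length-listsOfLength≤ : ∀ {A : Set} (xs : List A) L → length (listsOfLength≤ xs L) ≤ suc (length xs) ^ L
length-listsOfLength≤ xs zero    = ≤-refl
length-listsOfLength≤ xs (suc L) = begin
  suc (length (cartesianProductWith _∷_ xs (listsOfLength≤ xs L)))
    ≡⟨ cong suc (length-cartesianProductWith _∷_ xs _) ⟩
  suc (length xs * length (listsOfLength≤ xs L))
    ≤⟨ s≤s (*-monoʳ-≤ (length xs) (length-listsOfLength≤ xs L)) ⟩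
  suc (length xs * suc (length xs) ^ L)
    ≤⟨ +-monoˡ-≤ _ (m^n>0 (suc (length xs)) L) ⟩
  suc (length xs) ^ suc L ∎
  where open ≤-Reasoning

∈-apply : ∀ {A B : Set} (fs : List (A → B)) xs {f x} → f ∈ fs → x ∈ xs → f x ∈ cartesianProductWith _$_ fs xs
∈-apply fs xs = ∈-cartesianProductWith⁺ _$_

registerAccesses : List (ℕ → BasicInstr)
registerAccesses = inGet ∷ auxGet ∷ flip auxSet true ∷ flip auxSet false ∷ []

instructionModes : List (BasicInstr → PrimInstr)
instructionModes = plain ∷ ptest ∷ ntest ∷ []

basicInstructions : ℕ → List BasicInstr
basicInstructions B = outSet true ∷ outSet false ∷
  cartesianProductWith _$_ registerAccesses (upTo B)

instructions : ℕ → List PrimInstr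
instructions B = halt ∷ map jump (upTo B) ++
  cartesianProductWith _$_ instructionModes (basicInstructions B)

length-instructions : ∀ B → length (instructions B) ≡ 13 * B + 7
length-instructions B = begin
  suc (length (map jump (upTo B) ++ cartesianProductWith _$_ instructionModes (basicInstructions B)))
    ≡⟨ cong suc (length-++ (map jump (upTo B))) ⟩
  suc (length (map jump (upTo B)) + length (cartesianProductWith _$_ instructionModes (basicInstructions B)))
    ≡⟨ cong₂ (λ j t → suc (j + t)) (trans (length-map jump (upTo B)) (length-upTo B))
                                    (length-cartesianProductWith _$_ instructionModes (basicInstructions B)) ⟩
  suc (B + 3 * length (basicInstructions B))
    ≡⟨ cong (λ b → suc (B + 3 * b)) length-basicInstructions ⟩
  suc (B + 3 * (2 + 4 * B))
    ≡⟨ arith B ⟩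
  13 * B + 7 ∎
  where
  open ≡-Reasoning
  arith : ∀ B → suc (B + 3 * (2 + 4 * B)) ≡ 13 * B + 7
  arith = solve-∀
  length-basicInstructions : length (basicInstructions B) ≡ 2 + 4 * B
  length-basicInstructions = cong (2 +_) (trans
    (length-cartesianProductWith _$_ registerAccesses (upTo B))
    (cong (4 *_) (length-upTo B)))

-- Renaming aux:i to aux:(firstUse P i) is injective on the registers P uses, and input indices ≥ n
-- and jumps beyond the end of P lead to the same outcomes (badInput, inaction) whether capped or
-- not; so normalisation preserves behaviour while leaving finitely many programs of length ≤ L.
module Normalisation (n L : ℕ) (P : List PrimInstr) where

  normaliseBasic : BasicInstr → BasicInstr
  normaliseBasic (inGet i)    = inGet (i ⊓ n)
  normaliseBasic (auxGet i)   = auxGet (firstUse P i)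
  normaliseBasic (auxSet i b) = auxSet (firstUse P i) b
  normaliseBasic (outSet b)   = outSet b

  normaliseInstr : PrimInstr → PrimInstr
  normaliseInstr (plain a) = plain (normaliseBasic a)
  normaliseInstr (ptest a) = ptest (normaliseBasic a)
  normaliseInstr (ntest a) = ntest (normaliseBasic a)
  normaliseInstr (jump l)  = jump (l ⊓ suc L)
  normaliseInstr halt      = halt

  normalise : List PrimInstr
  normalise = map normaliseInstr P

  record Agree (s s′ : State) : Set where
    field
      out-agree : State.out s ≡ State.out s′
      aux-agree : ∀ {i} → InUse P i → State.aux s i ≡ State.aux s′ (firstUse P i)
  open Agree

  data ReplyAgree : Maybe (Bool × State) → Maybe (Bool × State) → Set where
    nothing : ReplyAgree nothing nothing
    just    : ∀ b {t t′} → Agree t t′ → ReplyAgree (just (b , t)) (just (b , t′))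

  doBasic-normalise : ∀ (v : Vec Bool n) a {s s′} → (∀ {i} → auxRegister a ≡ just i → InUse P i) →
                      Agree s s′ → ReplyAgree (doBasic v a s) (doBasic v (normaliseBasic a) s′)
  doBasic-normalise v (inGet i) used agree rewrite readIn-⊓ v i with readIn v i
  ... | nothing = nothing
  ... | just b  = just b agree
  doBasic-normalise v (auxGet i) used agree rewrite aux-agree agree (used refl) = just _ agree
  doBasic-normalise v (auxSet i b) {s} {s′} used agree = just b agree′
    where
    agree′ : Agree (st (updAux (State.aux s) i b) (State.out s))
                   (st (updAux (State.aux s′) (firstUse P i) b) (State.out s′))
    agree′ .out-agree = out-agree agree
    agree′ .aux-agree {j} j-used with i ≟ j
    ... | yes refl = trans (updAux-same _ i b) (sym (updAux-same _ (firstUse P i) b))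
    ... | no  i≢j  = begin
      updAux (State.aux s) i b j
        ≡⟨ updAux-other _ b i≢j ⟩
      State.aux s j
        ≡⟨ aux-agree agree j-used ⟩
      State.aux s′ (firstUse P j)
        ≡⟨ updAux-other _ b (i≢j ∘ firstUse-injective P (used refl)) ⟨
      updAux (State.aux s′) (firstUse P i) b (firstUse P j) ∎
      where open ≡-Reasoning
  doBasic-normalise v (outSet b) used agree =
    just b record { out-agree = refl ; aux-agree = aux-agree agree }

  exec-normalise : ∀ (v : Vec Bool n) k xs {s s′} → All (RegistersInUse P) xs → length xs ≤ L →
                   Agree s s′ → exec v k xs s ≡ exec v k (map normaliseInstr xs) s′
  exec-normalise v k       []       used xs≤L agree = refl
  exec-normalise v (suc k) (u ∷ xs) (_ ∷ used) xs≤L agree =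
    exec-normalise v k xs used (<⇒≤ xs≤L) agree
  exec-normalise v zero (halt ∷ xs) used xs≤L agree = cong terminated (out-agree agree)
  exec-normalise v zero (jump zero ∷ xs) used xs≤L agree = refl
  exec-normalise v zero (jump (suc l) ∷ xs) (_ ∷ used) xs≤L agree = begin
    exec v l xs _                                ≡⟨ exec-⊓ v l xs _ tail≤L ⟨
    exec v (l ⊓ L) xs _                          ≡⟨ exec-normalise v (l ⊓ L) xs used tail≤L agree ⟩
    exec v (l ⊓ L) (map normaliseInstr xs) _     ∎
    where
    open ≡-Reasoning
    tail≤L = <⇒≤ xs≤L
  exec-normalise v zero (plain a ∷ xs) {s} {s′} (u-used ∷ used) xs≤L agree
    with doBasic v a s | doBasic v (normaliseBasic a) s′ | doBasic-normalise v a u-used agree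
  ... | nothing | nothing | nothing = refl
  ... | just _ | just _ | just b agree′ = exec-normalise v zero xs used (<⇒≤ xs≤L) agree′
  exec-normalise v zero (ptest a ∷ xs) {s} {s′} (u-used ∷ used) xs≤L agree
    with doBasic v a s | doBasic v (normaliseBasic a) s′ | doBasic-normalise v a u-used agree
  ... | nothing | nothing | nothing = refl
  ... | just _ | just _ | just true  agree′ = exec-normalise v 0 xs used (<⇒≤ xs≤L) agree′
  ... | just _ | just _ | just false agree′ = exec-normalise v 1 xs used (<⇒≤ xs≤L) agree′
  exec-normalise v zero (ntest a ∷ xs) {s} {s′} (u-used ∷ used) xs≤L agree
    with doBasic v a s | doBasic v (normaliseBasic a) s′ | doBasic-normalise v a u-used agree
  ... | nothing | nothing | nothing = refl
  ... | just _ | just _ | just false agree′ = exec-normalise v 0 xs used (<⇒≤ xs≤L) agree′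
  ... | just _ | just _ | just true  agree′ = exec-normalise v 1 xs used (<⇒≤ xs≤L) agree′

  run-normalise : length P ≤ L → ∀ (v : Vec Bool n) → exec v 0 P initState ≡ exec v 0 normalise initState
  run-normalise P≤L v = exec-normalise v 0 P (registersInUse P) P≤L
    record { out-agree = refl ; aux-agree = λ _ → refl }

  private
    B = 2 + n + L

    register<B : ∀ {i} → InUse P i → length P ≤ L → firstUse P i < B
    register<B used P≤L = <-≤-trans (<-≤-trans used P≤L) (m≤n+m L (2 + n))

    normaliseBasic-∈ : length P ≤ L → ∀ a → (∀ {i} → auxRegister a ≡ just i → InUse P i) →
                       normaliseBasic a ∈ basicInstructions B
    normaliseBasic-∈ P≤L (inGet i) used = there (there (∈-apply registerAccesses (upTo B)
      (here refl) (∈-upTo⁺ (s≤s (≤-trans (m⊓n≤n i n) (≤-trans (m≤m+n n L) (n≤1+n _)))))))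
    normaliseBasic-∈ P≤L (auxGet i) used = there (there (∈-apply registerAccesses (upTo B)
      (there (here refl)) (∈-upTo⁺ (register<B (used refl) P≤L))))
    normaliseBasic-∈ P≤L (auxSet i true) used = there (there (∈-apply registerAccesses (upTo B)
      (there (there (here refl))) (∈-upTo⁺ (register<B (used refl) P≤L))))
    normaliseBasic-∈ P≤L (auxSet i false) used = there (there (∈-apply registerAccesses (upTo B)
      (there (there (there (here refl)))) (∈-upTo⁺ (register<B (used refl) P≤L))))
    normaliseBasic-∈ P≤L (outSet true)  used = here refl
    normaliseBasic-∈ P≤L (outSet false) used = there (here refl)

    normaliseInstr-∈ : length P ≤ L → ∀ u → RegistersInUse P u → normaliseInstr u ∈ instructions B
    normaliseInstr-∈ P≤L (plain a) used = there (∈-++⁺ʳ (map jump (upTo B))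
      (∈-apply instructionModes (basicInstructions B) (here refl) (normaliseBasic-∈ P≤L a used)))
    normaliseInstr-∈ P≤L (ptest a) used = there (∈-++⁺ʳ (map jump (upTo B))
      (∈-apply instructionModes (basicInstructions B) (there (here refl)) (normaliseBasic-∈ P≤L a used)))
    normaliseInstr-∈ P≤L (ntest a) used = there (∈-++⁺ʳ (map jump (upTo B))
      (∈-apply instructionModes (basicInstructions B) (there (there (here refl)))
        (normaliseBasic-∈ P≤L a used)))
    normaliseInstr-∈ P≤L (jump l)  used = there (∈-++⁺ˡ (∈-map⁺ jump
      (∈-upTo⁺ (s≤s (≤-trans (m⊓n≤n l (suc L)) (s≤s (m≤n+m L n)))))))
    normaliseInstr-∈ P≤L halt      used = here refl

  normalise-∈ : length P ≤ L → normalise ∈ listsOfLength≤ (instructions (2 + n + L)) L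
  normalise-∈ P≤L = ∈-listsOfLength≤ normalise
    (All.map⁺ (All.map (λ {u} → normaliseInstr-∈ P≤L u) (registersInUse P)))
    (≤-trans (≤-reflexive (length-map normaliseInstr P)) P≤L)

tailsWithHead : Bool → List (List Bool) → List (List Bool)
tailsWithHead b     []                   = []
tailsWithHead b     ([] ∷ ss)            = tailsWithHead b ss
tailsWithHead true  ((true  ∷ t) ∷ ss)   = t ∷ tailsWithHead true ss
tailsWithHead true  ((false ∷ t) ∷ ss)   = tailsWithHead true ss
tailsWithHead false ((true  ∷ t) ∷ ss)   = tailsWithHead false ss
tailsWithHead false ((false ∷ t) ∷ ss)   = t ∷ tailsWithHead false ss

∈-tailsWithHead : ∀ b {t ss} → (b ∷ t) ∈ ss → t ∈ tailsWithHead b ss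
∈-tailsWithHead true  (here refl) = here refl
∈-tailsWithHead false (here refl) = here refl
∈-tailsWithHead b     {ss = [] ∷ _}          (there p) = ∈-tailsWithHead b p
∈-tailsWithHead true  {ss = (true  ∷ _) ∷ _} (there p) = there (∈-tailsWithHead true p)
∈-tailsWithHead true  {ss = (false ∷ _) ∷ _} (there p) = ∈-tailsWithHead true p
∈-tailsWithHead false {ss = (true  ∷ _) ∷ _} (there p) = ∈-tailsWithHead false p
∈-tailsWithHead false {ss = (false ∷ _) ∷ _} (there p) = there (∈-tailsWithHead false p)

length-tailsWithHead : ∀ ss → length (tailsWithHead true ss) + length (tailsWithHead false ss) ≤ length ss
length-tailsWithHead []                 = z≤n
length-tailsWithHead ([] ∷ ss)          = m≤n⇒m≤1+n (length-tailsWithHead ss)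
length-tailsWithHead ((true  ∷ t) ∷ ss) = s≤s (length-tailsWithHead ss)
length-tailsWithHead ((false ∷ t) ∷ ss) =
  ≤-trans (≤-reflexive (+-suc _ _)) (s≤s (length-tailsWithHead ss))

-- Pigeonhole on the first bit: one of the two halves receives fewer than 2^w of the strings.
fresh : ℕ → List (List Bool) → List Bool
fresh zero    ss = []
fresh (suc w) ss with length (tailsWithHead true ss) <? 2 ^ w
... | yes _ = true  ∷ fresh w (tailsWithHead true ss)
... | no  _ = false ∷ fresh w (tailsWithHead false ss)

length-fresh : ∀ w ss → length (fresh w ss) ≡ w
length-fresh zero    ss = refl
length-fresh (suc w) ss with length (tailsWithHead true ss) <? 2 ^ w
... | yes _ = cong suc (length-fresh w _)
... | no  _ = cong suc (length-fresh w _)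

fresh-∉ : ∀ w ss → length ss < 2 ^ w → fresh w ss ∉ ss
fresh-∉ zero    []       _            ()
fresh-∉ zero    (_ ∷ ss) (s≤s ())
fresh-∉ (suc w) ss ss<2^w with length (tailsWithHead true ss) <? 2 ^ w
... | yes true<2^w = fresh-∉ w _ true<2^w ∘ ∈-tailsWithHead true
... | no  true≮2^w = fresh-∉ w _ false<2^w ∘ ∈-tailsWithHead false
  where
  false<2^w : length (tailsWithHead false ss) < 2 ^ w
  false<2^w = +-cancelˡ-< (2 ^ w) _ _ (begin-strict
    2 ^ w + length (tailsWithHead false ss)
      ≤⟨ +-monoˡ-≤ _ (≮⇒≥ true≮2^w) ⟩
    length (tailsWithHead true ss) + length (tailsWithHead false ss)
      ≤⟨ length-tailsWithHead ss ⟩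
    length ss
      <⟨ ss<2^w ⟩
    2 ^ w + (2 ^ w + 0)
      ≡⟨ cong (2 ^ w +_) (+-identityʳ _) ⟩
    2 ^ w + 2 ^ w ∎)
    where open ≤-Reasoning

allInputs : ∀ m → List (Vec Bool m)
allInputs zero    = [] ∷ []
allInputs (suc m) = map (true ∷_) (allInputs m) ++ map (false ∷_) (allInputs m)

truthTable : ∀ {m} → (Vec Bool m → Bool) → List Bool
truthTable {m} f = map f (allInputs m)

fromTable : ∀ m → List Bool → Vec Bool m → Bool
fromTable zero    []      []          = false
fromTable zero    (b ∷ _) []          = b
fromTable (suc m) s       (true  ∷ u) = fromTable m (take (2 ^ m) s) u
fromTable (suc m) s       (false ∷ u) = fromTable m (drop (2 ^ m) s) u

truthTable-fromTable : ∀ m s → length s ≡ 2 ^ m → truthTable (fromTable m s) ≡ s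
truthTable-fromTable zero    (b ∷ []) _ = refl
truthTable-fromTable (suc m) s |s| = begin
  map f (map (true ∷_) (allInputs m) ++ map (false ∷_) (allInputs m))
    ≡⟨ map-++ f (map (true ∷_) (allInputs m)) _ ⟩
  map f (map (true ∷_) (allInputs m)) ++ map f (map (false ∷_) (allInputs m))
    ≡⟨ cong₂ _++_ (sym (map-∘ (allInputs m))) (sym (map-∘ (allInputs m))) ⟩
  truthTable (fromTable m (take (2 ^ m) s)) ++ truthTable (fromTable m (drop (2 ^ m) s))
    ≡⟨ cong₂ _++_ (truthTable-fromTable m _ |take|) (truthTable-fromTable m _ |drop|) ⟩
  take (2 ^ m) s ++ drop (2 ^ m) s
    ≡⟨ take++drop≡id (2 ^ m) s ⟩
  s ∎
  where
  open ≡-Reasoning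
  f = fromTable (suc m) s
  |s|′ : length s ≡ 2 ^ m + 2 ^ m
  |s|′ = trans |s| (cong (2 ^ m +_) (+-identityʳ _))
  |take| : length (take (2 ^ m) s) ≡ 2 ^ m
  |take| = trans (length-take (2 ^ m) s) (m≤n⇒m⊓n≡m (≤-trans (m≤m+n _ _) (≤-reflexive (sym |s|′))))
  |drop| : length (drop (2 ^ m) s) ≡ 2 ^ m
  |drop| = trans (length-drop (2 ^ m) s) (trans (cong (_∸ 2 ^ m) |s|′) (m+n∸m≡n (2 ^ m) (2 ^ m)))

input : ∀ {n} → Vec Bool n → ℕ → Bool
input []      i       = false
input (b ∷ v) zero    = b
input (b ∷ v) (suc i) = input v i

inputs : ∀ {n} → Vec Bool n → ℕ → (d : ℕ) → Vec Bool d
inputs v i zero    = []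
inputs v i (suc d) = input v i ∷ inputs v (suc i) d

padTo : ∀ {m} n → Vec Bool m → Vec Bool n
padTo zero    u       = []
padTo (suc n) []      = false ∷ padTo n []
padTo (suc n) (b ∷ u) = b ∷ padTo n u

readIn-< : ∀ {n} (v : Vec Bool n) {i} → i < n → readIn v i ≡ just (input v i)
readIn-< (b ∷ v) {zero}  _         = refl
readIn-< (b ∷ v) {suc i} (s≤s i<n) = readIn-< v i<n

inputs-∷ : ∀ {n} b (v : Vec Bool n) i d → inputs (b ∷ v) (suc i) d ≡ inputs v i d
inputs-∷ b v i zero    = refl
inputs-∷ b v i (suc d) = cong (input v i ∷_) (inputs-∷ b v (suc i) d)

inputs-padTo : ∀ {m} (u : Vec Bool m) n → m ≤ n → inputs (padTo n u) 0 m ≡ u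
inputs-padTo []      n       _         = refl
inputs-padTo (b ∷ u) (suc n) (s≤s m≤n) =
  cong (b ∷_) (trans (inputs-∷ b (padTo n u) 0 _) (inputs-padTo u n m≤n))

-- -in:i skips the jump to the F-subtree exactly when in:i holds.
decisionTree : (d i : ℕ) → (Vec Bool d → Bool) → List⁺ PrimInstr
decisionTree zero    i g = plain (outSet (g [])) ∷ halt ∷ []
decisionTree (suc d) i g = ntest (inGet i) ∷ jump (suc (length⁺ T)) ∷ toList T ++ toList F
  where
  T = decisionTree d (suc i) (g ∘ (true ∷_))
  F = decisionTree d (suc i) (g ∘ (false ∷_))

decisionTree-correct : ∀ d i g {n} (v : Vec Bool n) s rest → i + d ≤ n →
                       exec v 0 (toList (decisionTree d i g) ++ rest) s ≡ terminated (g (inputs v i d))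
decisionTree-correct zero    i g v s rest _ = refl
decisionTree-correct (suc d) i g v s rest i+d≤n
  rewrite readIn-< v (<-≤-trans (m<m+n i z<s) i+d≤n) with input v i
... | true  = begin
  exec v 0 ((toList T ++ toList F) ++ rest) s  ≡⟨ cong (λ xs → exec v 0 xs s) (++-assoc (toList T) _ rest) ⟩
  exec v 0 (toList T ++ toList F ++ rest) s    ≡⟨ decisionTree-correct d (suc i) _ v s _ i+1+d≤n ⟩
  terminated (g (true ∷ inputs v (suc i) d))   ∎
  where
  open ≡-Reasoning
  T = decisionTree d (suc i) (g ∘ (true ∷_))
  F = decisionTree d (suc i) (g ∘ (false ∷_))
  i+1+d≤n = ≤-trans (≤-reflexive (sym (+-suc i d))) i+d≤n
... | false = begin
  exec v (length⁺ T) ((toList T ++ toList F) ++ rest) s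
    ≡⟨ cong (λ xs → exec v (length⁺ T) xs s) (++-assoc (toList T) _ rest) ⟩
  exec v (length⁺ T) (toList T ++ toList F ++ rest) s
    ≡⟨ cong (λ k → exec v k (toList T ++ toList F ++ rest) s) (+-identityʳ (length⁺ T)) ⟨
  exec v (length⁺ T + 0) (toList T ++ toList F ++ rest) s
    ≡⟨ exec-++ v (toList T) 0 s ⟩
  exec v 0 (toList F ++ rest) s
    ≡⟨ decisionTree-correct d (suc i) _ v s _ i+1+d≤n ⟩
  terminated (g (false ∷ inputs v (suc i) d)) ∎
  where
  open ≡-Reasoning
  T = decisionTree d (suc i) (g ∘ (true ∷_))
  F = decisionTree d (suc i) (g ∘ (false ∷_))
  i+1+d≤n = ≤-trans (≤-reflexive (sym (+-suc i d))) i+d≤n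

length-decisionTree : ∀ d i g → length⁺ (decisionTree d i g) + 2 ≡ 4 * 2 ^ d
length-decisionTree zero    i g = refl
length-decisionTree (suc d) i g = begin
  2 + length (toList T ++ toList F) + 2         ≡⟨ cong (λ l → 2 + l + 2) (length-++ (toList T)) ⟩
  2 + (length⁺ T + length⁺ F) + 2               ≡⟨ arith (length⁺ T) (length⁺ F) ⟩
  (length⁺ T + 2) + (length⁺ F + 2)             ≡⟨ cong₂ _+_ (length-decisionTree d _ _)
                                                              (length-decisionTree d _ _) ⟩
  4 * 2 ^ d + 4 * 2 ^ d                         ≡⟨ arith′ (2 ^ d) ⟩
  4 * 2 ^ suc d                                 ∎
  where
  open ≡-Reasoning
  T = decisionTree d (suc i) (g ∘ (true ∷_))
  F = decisionTree d (suc i) (g ∘ (false ∷_))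
  arith : ∀ a b → 2 + (a + b) + 2 ≡ (a + 2) + (b + 2)
  arith = solve-∀
  arith′ : ∀ p → 4 * p + 4 * p ≡ 4 * (2 * p)
  arith′ = solve-∀

output : Outcome → Bool
output (terminated b) = b
output inaction       = false
output badInput       = false

tables : (n L m : ℕ) → List (List Bool)
tables n L m = map (λ c → truthTable {m} (λ u → output (exec (padTo n u) 0 c initState)))
                   (listsOfLength≤ (instructions (2 + n + L)) L)

truthTable-∈-tables : ∀ {n m} L (g : Vec Bool m → Bool) (X : ISbr) → m ≤ n →
                      Computes X (λ v → g (inputs v 0 m)) → length⁺ X ≤ L → truthTable g ∈ tables n L m
truthTable-∈-tables {n} {m} L g X m≤n computes X≤L =
  subst (_∈ tables n L m) (map-cong agree (allInputs m)) (∈-map⁺ _ (normalise-∈ X≤L))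
  where
  open Normalisation n L (toList X)
  agree : ∀ u → output (exec (padTo n u) 0 normalise initState) ≡ g u
  agree u = begin
    output (exec (padTo n u) 0 normalise initState)       ≡⟨ cong output (run-normalise X≤L (padTo n u)) ⟨
    output (exec (padTo n u) 0 (toList X) initState)      ≡⟨ cong output (computes (padTo n u)) ⟩
    g (inputs (padTo n u) 0 m)                            ≡⟨ cong g (inputs-padTo u n m≤n) ⟩
    g u                                                   ∎
    where open ≡-Reasoning

hardFunction : (n L m : ℕ) → Vec Bool m → Bool
hardFunction n L m = fromTable m (fresh (2 ^ m) (tables n L m))

hardFunction-lowerBound : ∀ {n L m} → m ≤ n → length (tables n L m) < 2 ^ (2 ^ m) → (X : ISbr) →
                          Computes X (λ v → hardFunction n L m (inputs v 0 m)) → L < length⁺ X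
hardFunction-lowerBound {n} {L} {m} m≤n few X computes = ≰⇒> λ X≤L →
  fresh-∉ (2 ^ m) (tables n L m) few
    (subst (_∈ tables n L m) (truthTable-fromTable m _ (length-fresh (2 ^ m) _))
      (truthTable-∈-tables L (hardFunction n L m) X m≤n computes X≤L))

decisionTree-computes : ∀ {n m} (g : Vec Bool m → Bool) → m ≤ n →
                        Computes {n} (decisionTree m 0 g) (λ v → g (inputs v 0 m))
decisionTree-computes {m = m} g m≤n v =
  trans (cong (λ xs → exec v 0 xs initState) (sym (++-identityʳ (toList (decisionTree m 0 g)))))
        (decisionTree-correct m 0 g v initState [] m≤n)

length-tables : ∀ n L m → length (tables n L m) ≤ (13 * (2 + n + L) + 8) ^ L
length-tables n L m = begin
  length (tables n L m)                               ≡⟨ length-map _ (listsOfLength≤ (instructions B) L) ⟩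
  length (listsOfLength≤ (instructions B) L)          ≤⟨ length-listsOfLength≤ (instructions B) L ⟩
  suc (length (instructions B)) ^ L                   ≡⟨ cong (λ l → suc l ^ L) (length-instructions B) ⟩
  suc (13 * B + 7) ^ L                                ≡⟨ cong (_^ L) (+-suc (13 * B) 7) ⟨
  (13 * B + 8) ^ L                                    ∎
  where
  open ≤-Reasoning
  B = 2 + n + L

length-tables-< : ∀ n L m a → 13 * (2 + n + L) + 8 ≤ 2 ^ a → a * L < 2 ^ m →
                  length (tables n L m) < 2 ^ (2 ^ m)
length-tables-< n L m a alphabet≤2^a aL<2^m = begin-strict
  length (tables n L m)           ≤⟨ length-tables n L m ⟩
  (13 * (2 + n + L) + 8) ^ L      ≤⟨ ^-monoˡ-≤ L alphabet≤2^a ⟩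
  (2 ^ a) ^ L                     ≡⟨ ^-*-assoc 2 a L ⟩
  2 ^ (a * L)                     <⟨ ^-monoʳ-< 2 (s≤s (s≤s z≤n)) aL<2^m ⟩
  2 ^ (2 ^ m)                     ∎
  where open ≤-Reasoning

n<2^n : ∀ n → n < 2 ^ n
n<2^n zero    = s≤s z≤n
n<2^n (suc n) = begin
  2 + n            ≡⟨ +-comm 1 (suc n) ⟩
  suc n + 1        ≤⟨ +-mono-≤ (n<2^n n) (m^n>0 2 n) ⟩
  2 ^ n + 2 ^ n    ≡⟨ cong (2 ^ n +_) (+-identityʳ (2 ^ n)) ⟨
  2 ^ suc n        ∎
  where open ≤-Reasoning

2^⌊log2⌋≤ : ∀ n (rec : Acc _<_ n) → 1 ≤ n → 2 ^ ⌊log2⌋ n rec ≤ n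
2^⌊log2⌋≤ 1             _        _ = ≤-refl
2^⌊log2⌋≤ (suc (suc n)) (acc rs) _ = begin
  2 * 2 ^ ⌊log2⌋ (suc ⌊ n /2⌋) _     ≤⟨ *-monoʳ-≤ 2 (2^⌊log2⌋≤ (suc ⌊ n /2⌋) _ (s≤s z≤n)) ⟩
  2 * suc ⌊ n /2⌋                    ≡⟨ *-distribˡ-+ 2 1 ⌊ n /2⌋ ⟩
  2 + 2 * ⌊ n /2⌋                    ≤⟨ +-monoʳ-≤ 2 double-half≤ ⟩
  2 + n                              ∎
  where
  open ≤-Reasoning
  double-half≤ : 2 * ⌊ n /2⌋ ≤ n
  double-half≤ = begin
    2 * ⌊ n /2⌋                ≡⟨ cong (⌊ n /2⌋ +_) (+-identityʳ _) ⟩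
    ⌊ n /2⌋ + ⌊ n /2⌋          ≤⟨ +-monoʳ-≤ ⌊ n /2⌋ (⌊n/2⌋≤⌈n/2⌉ n) ⟩
    ⌊ n /2⌋ + ⌈ n /2⌉          ≡⟨ ⌊n/2⌋+⌈n/2⌉≡n n ⟩
    n                          ∎

2^⌊log₂n⌋≤n : ∀ n → 1 ≤ n → 2 ^ ⌊log₂ n ⌋ ≤ n
2^⌊log₂n⌋≤n n = 2^⌊log2⌋≤ n (<-wellFounded n)

polynomial<exponential : ∀ A N → ∃[ j ] N ≤ j × A * (j * j) < 2 ^ j
polynomial<exponential A N = y * 10 , N≤j , Aj²<2^j
  where
  y = suc (A + N)
  N≤j : N ≤ y * 10
  N≤j = ≤-trans (m≤n+m N A) (≤-trans (n≤1+n _) (m≤m*n y 10))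
  arith : ∀ y → y * (y * 10 * (y * 10)) ≡ 100 * (y * (y * (y * 1)))
  arith = solve-∀
  Aj²<2^j : A * (y * 10 * (y * 10)) < 2 ^ (y * 10)
  Aj²<2^j = begin-strict
    A * (y * 10 * (y * 10))       ≤⟨ *-monoˡ-≤ _ (≤-trans (m≤m+n A N) (n≤1+n _)) ⟩
    y * (y * 10 * (y * 10))       ≡⟨ arith y ⟩
    100 * y ^ 3                   ≤⟨ *-monoʳ-≤ 100 (^-monoˡ-≤ 3 (n≤1+n y)) ⟩
    100 * suc y ^ 3               <⟨ *-monoˡ-< (suc y ^ 3) {{m^n≢0 (suc y) 3}} {100} {128}
                                                (s≤s (m≤m+n 100 27)) ⟩
    128 * suc y ^ 3               ≤⟨ *-monoˡ-≤ (suc y ^ 3) (^-monoˡ-≤ 7 {2} {suc y} (s≤s (s≤s z≤n))) ⟩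
    suc y ^ 7 * suc y ^ 3         ≡⟨ ^-distribˡ-+-* (suc y) 7 3 ⟨
    suc y ^ 10                    ≤⟨ ^-monoˡ-≤ 10 (n<2^n y) ⟩
    (2 ^ y) ^ 10                  ≡⟨ ^-*-assoc 2 y 10 ⟩
    2 ^ (y * 10)                  ∎
    where open ≤-Reasoning

13*[2+n+L]+8≤64*E : ∀ {n L E} → n ≤ E → L ≤ E → 1 ≤ E → 13 * (2 + n + L) + 8 ≤ 64 * E
13*[2+n+L]+8≤64*E {n} {L} {E} n≤E L≤E 1≤E = begin
  13 * (2 + n + L) + 8          ≤⟨ +-mono-≤ (*-monoʳ-≤ 13 (+-mono-≤ (+-monoˡ-≤ n (*-monoʳ-≤ 2 1≤E)) L≤E))
                                            (*-monoʳ-≤ 8 1≤E) ⟩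
  13 * (2 * E + n + E) + 8 * E  ≤⟨ +-monoˡ-≤ (8 * E) (*-monoʳ-≤ 13 (+-monoˡ-≤ E (+-monoʳ-≤ (2 * E) n≤E))) ⟩
  13 * (2 * E + E + E) + 8 * E  ≡⟨ arith E ⟩
  60 * E                        ≤⟨ *-monoˡ-≤ E (m≤m+n 60 4) ⟩
  64 * E                        ∎
  where
  open ≤-Reasoning
  arith : ∀ E → 13 * (2 * E + E + E) + 8 * E ≡ 60 * E
  arith = solve-∀

length-tables-at-2^ : ∀ k j → (6 + suc k * j) * j < 2 ^ j →
                      length (tables (2 ^ j) ((2 ^ j) ^ k * j) (suc k * j)) < 2 ^ (2 ^ (suc k * j))
length-tables-at-2^ k j aj<n =
  length-tables-< n L (suc k * j) a (≤-trans (13*[2+n+L]+8≤64*E n≤E L≤E 1≤E) (≤-reflexive 64E≡2^a)) aL<2^m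
  where
  open ≤-Reasoning
  n = 2 ^ j
  L = n ^ k * j
  a = 6 + suc k * j
  instance
    n≢0 : NonZero n
    n≢0 = m^n≢0 2 j
    nᵏ≢0 : NonZero (n ^ k)
    nᵏ≢0 = m^n≢0 n k
  1≤E : 1 ≤ n ^ suc k
  1≤E = m^n>0 n (suc k)
  2^m≡nᵏ⁺¹ : 2 ^ (suc k * j) ≡ n ^ suc k
  2^m≡nᵏ⁺¹ = trans (cong (2 ^_) (*-comm (suc k) j)) (sym (^-*-assoc 2 j (suc k)))
  n≤E : n ≤ n ^ suc k
  n≤E = m≤m*n n (n ^ k)
  L≤E : L ≤ n ^ suc k
  L≤E = ≤-trans (*-monoʳ-≤ (n ^ k) (<⇒≤ (n<2^n j))) (≤-reflexive (*-comm (n ^ k) n))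
  64E≡2^a : 64 * n ^ suc k ≡ 2 ^ a
  64E≡2^a = trans (cong (64 *_) (sym 2^m≡nᵏ⁺¹)) (sym (^-distribˡ-+-* 2 6 (suc k * j)))
  aL<2^m : a * L < 2 ^ (suc k * j)
  aL<2^m = begin-strict
    a * (n ^ k * j)     ≡⟨ arith a (n ^ k) j ⟩
    (a * j) * n ^ k     <⟨ *-monoˡ-< (n ^ k) aj<n ⟩
    n ^ suc k           ≡⟨ 2^m≡nᵏ⁺¹ ⟨
    2 ^ (suc k * j)     ∎
    where
    arith : ∀ a p j → a * (p * j) ≡ (a * j) * p
    arith = solve-∀

InISbrO-nᵏ⇒nᵏ⁺¹ : ∀ k F → InISbrO (λ n → n ^ k) F → InISbrO (λ n → n ^ suc k) F
InISbrO-nᵏ⇒nᵏ⁺¹ k F (h , (c , N , h≤cnᵏ) , programs) = h , (c , suc N , h≤cnᵏ⁺¹) , programs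
  where
  h≤cnᵏ⁺¹ : ∀ n → suc N ≤ n → h n ≤ c * n ^ suc k
  h≤cnᵏ⁺¹ (suc n) (s≤s N≤n) =
    ≤-trans (h≤cnᵏ (suc n) (m≤n⇒m≤1+n N≤n)) (*-monoʳ-≤ c (m≤n*m (suc n ^ k) (suc n)))

module Separation (k : ℕ) where

  width : ℕ → ℕ
  width n = suc k * ⌊log₂ n ⌋ ⊓ n

  budget : ℕ → ℕ
  budget n = n ^ k * ⌊log₂ n ⌋

  family : BFFamily
  family n v = hardFunction n (budget n) (width n) (inputs v 0 (width n))

  width≤ : ∀ n → width n ≤ n
  width≤ n = m⊓n≤n (suc k * ⌊log₂ n ⌋) n

  2^width≤ : ∀ n → 1 ≤ n → 2 ^ width n ≤ n ^ suc k
  2^width≤ n 1≤n = begin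
    2 ^ width n                 ≤⟨ ^-monoʳ-≤ 2 (m⊓n≤m (suc k * ⌊log₂ n ⌋) n) ⟩
    2 ^ (suc k * ⌊log₂ n ⌋)     ≡⟨ cong (2 ^_) (*-comm (suc k) ⌊log₂ n ⌋) ⟩
    2 ^ (⌊log₂ n ⌋ * suc k)     ≡⟨ ^-*-assoc 2 ⌊log₂ n ⌋ (suc k) ⟨
    (2 ^ ⌊log₂ n ⌋) ^ suc k     ≤⟨ ^-monoˡ-≤ (suc k) (2^⌊log₂n⌋≤n n 1≤n) ⟩
    n ^ suc k                   ∎
    where open ≤-Reasoning

  family∈O[nᵏ⁺¹] : InISbrO (λ n → n ^ suc k) family
  family∈O[nᵏ⁺¹] = (λ n → 4 * 2 ^ width n) , (4 , 1 , λ n 1≤n → *-monoʳ-≤ 4 (2^width≤ n 1≤n)) , λ n →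
    let g = hardFunction n (budget n) (width n) in
    decisionTree (width n) 0 g , decisionTree-computes g (width≤ n) ,
    ≤-trans (m≤m+n _ 2) (≤-reflexive (length-decisionTree (width n) 0 g))

  width-at-2^ : ∀ j → suc k * j ≤ 2 ^ j → width (2 ^ j) ≡ suc k * j
  width-at-2^ j kj≤n = trans (cong (λ l → suc k * l ⊓ 2 ^ j) (⌊log₂[2^n]⌋≡n j)) (m≤n⇒m⊓n≡m kj≤n)

  budget-at-2^ : ∀ j → budget (2 ^ j) ≡ (2 ^ j) ^ k * j
  budget-at-2^ j = cong ((2 ^ j) ^ k *_) (⌊log₂[2^n]⌋≡n j)

  family-lowerBound : ∀ j .{{_ : NonZero j}} → (k + 7) * (j * j) < 2 ^ j →
                      (X : ISbr) → Computes X (family (2 ^ j)) → (2 ^ j) ^ k * j < length⁺ X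
  family-lowerBound j growth X computes = subst (_< length⁺ X) (budget-at-2^ j)
    (hardFunction-lowerBound {2 ^ j} {budget (2 ^ j)} {width (2 ^ j)} (width≤ (2 ^ j)) few X computes)
    where
    open ≤-Reasoning
    aj<n : (6 + suc k * j) * j < 2 ^ j
    aj<n = begin-strict
      (6 + suc k * j) * j       ≤⟨ *-monoˡ-≤ j (+-monoˡ-≤ (suc k * j) (m≤m*n 6 j)) ⟩
      (6 * j + suc k * j) * j   ≡⟨ arith k j ⟩
      (k + 7) * (j * j)         <⟨ growth ⟩
      2 ^ j                     ∎
      where
      arith : ∀ k j → (6 * j + suc k * j) * j ≡ (k + 7) * (j * j)
      arith = solve-∀
    kj≤n : suc k * j ≤ 2 ^ j
    kj≤n = ≤-trans (m≤n+m (suc k * j) 6) (≤-trans (m≤m*n (6 + suc k * j) j) (<⇒≤ aj<n))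
    few : length (tables (2 ^ j) (budget (2 ^ j)) (width (2 ^ j))) < 2 ^ (2 ^ width (2 ^ j))
    few = subst₂ (λ L m → length (tables (2 ^ j) L m) < 2 ^ (2 ^ m))
                 (sym (budget-at-2^ j)) (sym (width-at-2^ j kj≤n)) (length-tables-at-2^ k j aj<n)

  family∉O[nᵏ] : ¬ InISbrO (λ n → n ^ k) family
  family∉O[nᵏ] (h , (c , N , h≤cnᵏ) , programs) = absurd (polynomial<exponential (k + 7) (suc (N + c)))
    where
    absurd : (∃[ j ] suc (N + c) ≤ j × (k + 7) * (j * j) < 2 ^ j) → ⊥
    absurd (j , N+c<j , growth) = <⇒≱ (family-lowerBound j {{j≢0}} growth X computes) X≤budget
      where
      j≢0 : NonZero j
      j≢0 = >-nonZero (<-≤-trans z<s N+c<j)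
      X = proj₁ (programs (2 ^ j))
      computes = proj₁ (proj₂ (programs (2 ^ j)))
      N≤j : N ≤ j
      N≤j = ≤-trans (m≤m+n N c) (<⇒≤ N+c<j)
      c≤j : c ≤ j
      c≤j = ≤-trans (m≤n+m c N) (<⇒≤ N+c<j)
      X≤budget : length⁺ X ≤ (2 ^ j) ^ k * j
      X≤budget = begin
        length⁺ X         ≤⟨ proj₂ (proj₂ (programs (2 ^ j))) ⟩
        h (2 ^ j)         ≤⟨ h≤cnᵏ (2 ^ j) (≤-trans N≤j (<⇒≤ (n<2^n j))) ⟩
        c * (2 ^ j) ^ k   ≤⟨ *-monoˡ-≤ ((2 ^ j) ^ k) c≤j ⟩
        j * (2 ^ j) ^ k   ≡⟨ *-comm j ((2 ^ j) ^ k) ⟩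
        (2 ^ j) ^ k * j   ∎
        where open ≤-Reasoning

theorem4 : (k : ℕ) →
    (∀ F → InISbrO (λ n → n ^ k) F → InISbrO (λ n → n ^ suc k) F) ×
    Σ BFFamily (λ F → InISbrO (λ n → n ^ suc k) F × ¬ InISbrO (λ n → n ^ k) F)
theorem4 k = InISbrO-nᵏ⇒nᵏ⁺¹ k , family , family∈O[nᵏ⁺¹] , family∉O[nᵏ]
  where open Separation k
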